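{- Let $p$ be a positive integer, $H$ a graph, $T$ a complete rooted ternary tree and $V\subseteq V(T(H))$ with $|OC(T,V)|>p$. Then there exists a minimal sequence of largest subtrees of $T$ with respect to $V$ lacking $p$.
   Context: $T(H)$: disjoint copies $H^w$ ($w\in V(T)$) of $H$ with $w^i$ the copy of vertex $i$, plus edges $\{w^i,z^i\}$ for each vertex $i$ of $H$ and each edge $\{w,z\}$ of $T$; for a subtree $T'$ of $T$, $T'(H)$ is the subgraph formed by the copies over $V(T')$. For a subtree $T'$ and $V'\subseteq V(T(H))$, $OC(T',V')$ is the set of $w\in V(T')$ with $V(H^w)\cap V'\ne\emptyset$. A complete rooted ternary tree is a rooted tree in which every non-leaf vertex has 3 children and all root-leaf paths have the same length. An immediate subtree of $T$ is the subtree consisting of a child of the root and all its descendants; it is a largest immediate subtree w.r.t. $V$ if $|OC(T,V)\cap V(T')|$ is maximum among the immediate subtrees $T'$. A sequence of largest subtrees of $T$ w.r.t. $V$ is $T_1,\dots,T_q$ with $T_1=T$, $T_{i+1}$ a largest immediate subtree of $T_i$ w.r.t. $V_i$, with associated sets $V_1=V$, $V_{i+1}=V_i\cap V(T_{i+1}(H))$. It is a minimal sequence of largest subtrees lacking $p$ if $|OC(T_1,V_1)|-|OC(T_q,V_q)|\ge p$ while $|OC(T_1,V_1)|-|OC(T_{q-1},V_{q-1})|<p$. -}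

module Defs where

open import Data.Nat using (ℕ; zero; suc; _+_; _∸_; _≤_; _<_)
open import Data.Bool using (Bool; true; false; _∧_)
open import Data.Fin using (Fin)
open import Data.Fin.Properties using () renaming (_≟_ to _≟F_)
open import Data.List using (List; []; _∷_; [_]; _++_; map; concatMap; allFin; filterᵇ; length)
open import Data.List.Properties using (≡-dec)
open import Data.Bool.ListAction using (any)
open import Data.Product using (Σ; _×_; _,_; ∃-syntax)
open import Relation.Binary.PropositionalEquality using (_≡_)
open import Relation.Nullary using (¬_)
open import Relation.Nullary.Decidable using (⌊_⌋)

record Graph : Set₁ where
  field
    n      : ℕ
    Adj    : Fin n → Fin n → Set
    sym    : ∀ {i j} → Adj i j → Adj j i
    irrefl : ∀ {i} → ¬ Adj i i

-- Vertices of a complete rooted ternary tree are addressed by the path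
-- from the root: a list of child indices (Fin 3).
Addr : Set
Addr = List (Fin 3)

_≟A_ : (u w : Addr) → Relation.Nullary.Dec (u ≡ w)
_≟A_ = ≡-dec _≟F_

allVerts : ℕ → List Addr
allVerts zero    = [] ∷ []
allVerts (suc h) = [] ∷ concatMap (λ c → map (c ∷_) (allVerts h)) (allFin 3)

-- A subtree of the tree: the subtree rooted at address 'root' consisting of
-- it and all its descendants; 'height' is its remaining height.
record Sub : Set where
  constructor sub
  field
    root   : Addr
    height : ℕ
open Sub public

tree : ℕ → Sub
tree d = sub [] d

verts : Sub → List Addr
verts S = map (root S ++_) (allVerts (height S))

inSub : Sub → Addr → Bool
inSub S w = any (λ x → ⌊ w ≟A x ⌋) (verts S)

-- A subset of the vertex set of T(H): vertex w^i is (w , i).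
VSet : ℕ → Set
VSet n = Addr → Fin n → Bool

restrict : ∀ {n} → VSet n → Sub → VSet n
restrict V S w i = V w i ∧ inSub S w

OC : ∀ {n} → Sub → VSet n → List Addr
OC {n} S V = filterᵇ (λ w → any (λ i → V w i) (allFin n)) (verts S)

∣OC∣ : ∀ {n} → Sub → VSet n → ℕ
∣OC∣ S V = length (OC S V)

child : Sub → Fin 3 → Sub
child S c = sub (root S ++ [ c ]) (height S ∸ 1)

ImmSub : Sub → Sub → Set
ImmSub S S' = (0 < height S) × (∃[ c ] (S' ≡ child S c))

cntIn : ∀ {n} → Sub → VSet n → Sub → ℕ
cntIn S V S' = length (filterᵇ (inSub S') (OC S V))

LargestImm : ∀ {n} → Sub → VSet n → Sub → Set
LargestImm S V S' =
  ImmSub S S' × (∀ S'' → ImmSub S S'' → cntIn S V S'' ≤ cntIn S V S')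

-- A sequence of largest subtrees T_1..T_q (stored 0-based: Ts 0 = T_1).
record LargestSeq {n} (T : Sub) (V : VSet n) (q : ℕ) : Set where
  field
    Ts    : ℕ → Sub
    Vs    : ℕ → VSet n
    pos   : 1 ≤ q
    first : (Ts 0 ≡ T) × (Vs 0 ≡ V)
    step  : ∀ i → suc i < q →
            LargestImm (Ts i) (Vs i) (Ts (suc i))
            × (Vs (suc i) ≡ restrict (Vs i) (Ts (suc i)))

-- minimal sequence lacking p:
-- |OC(T_1,V_1)| - |OC(T_q,V_q)| ≥ p  and  |OC(T_1,V_1)| - |OC(T_{q-1},V_{q-1})| < p
-- (q ≥ 2 since T_{q-1} is mentioned; differences written additively)
Lacking : ∀ {n} {T : Sub} {V : VSet n} {q : ℕ} → ℕ → LargestSeq T V q → Set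
Lacking {q = q} p s =
  (2 ≤ q)
  × (p + ∣OC∣ (Ts (q ∸ 1)) (Vs (q ∸ 1)) ≤ ∣OC∣ (Ts 0) (Vs 0))
  × (∣OC∣ (Ts 0) (Vs 0) < p + ∣OC∣ (Ts (q ∸ 2)) (Vs (q ∸ 2)))
  where open LargestSeq s

-- Starting from (T , V), repeatedly descend into a largest immediate
-- subtree (the greedy walk).  Its i-th term is a subtree of height d ∸ i, so
-- every prefix of length q ≤ d + 1 is a sequence of largest subtrees.  Write
-- O i for |OC| of the i-th term.  Consider the property "p + O i ≤ O 0"
-- (the walk has lost at least p occupied copies).  It fails at i = 0 since
-- p > 0, and it holds at i = d: the d-th term is a single vertex, so O d ≤ 1,
-- while p < O 0.  Hence there is a first crossing j < d where it fails at j
-- and holds at j + 1; the prefix of length q = j + 2 is the required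
-- minimal sequence lacking p.
module Submission where

open import Defs
open import Data.Bool using (T?)
open import Data.Bool.ListAction using (any)
open import Data.Empty using (⊥-elim)
open import Data.Fin using (Fin; zero; suc)
open import Data.List using (allFin)
open import Data.List.Properties using (length-filter)
open import Data.Nat using (ℕ; zero; suc; _+_; _∸_; _≤_; _<_; _≤?_; z≤n; s≤s)
open import Data.Nat.Properties
open import Data.Product using (Σ; ∃-syntax; _×_; _,_; proj₁; proj₂)
open import Function using (_∘_)
open import Relation.Binary.PropositionalEquality using (_≡_; refl; cong; trans; module ≡-Reasoning)
open import Relation.Nullary using (¬_; yes; no)
open import Relation.Unary using (Decidable)

argmax : ∀ {k} (f : Fin (suc k) → ℕ) → Σ (Fin (suc k)) λ c → ∀ c' → f c' ≤ f c
argmax {zero}  f = zero , λ { zero → ≤-refl }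
argmax {suc k} f with (c , c-max) ← argmax (f ∘ suc) | f zero ≤? f (suc c)
... | yes f0≤fc = suc c , λ { zero → f0≤fc ; (suc c') → c-max c' }
... | no  f0≰fc = zero  , λ { zero → ≤-refl
                            ; (suc c') → ≤-trans (c-max c') (<⇒≤ (≰⇒> f0≰fc)) }

first-crossing : (P : ℕ → Set) → Decidable P → ¬ P 0 →
                 ∀ d → P d → ∃[ j ] (j < d × ¬ P j × P (suc j))
first-crossing P P? ¬P0 zero    P0 = ⊥-elim (¬P0 P0)
first-crossing P P? ¬P0 (suc d) Pd+1 with P? d
... | no ¬Pd = d , ≤-refl , ¬Pd , Pd+1
... | yes Pd with (j , j<d , ¬Pj , Pj+1) ← first-crossing P P? ¬P0 d Pd =
  j , m≤n⇒m≤1+n j<d , ¬Pj , Pj+1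

-- A subtree of height 0 is a single vertex, so it has at most one occupied
-- copy.  This bounds |OC| at the end of the greedy walk.
∣OC∣-leaf : ∀ {n} (S : Sub) (W : VSet n) → height S ≡ 0 → ∣OC∣ S W ≤ 1
∣OC∣-leaf {n} (sub r .0) W refl =
  length-filter (T? ∘ λ w → any (λ i → W w i) (allFin n)) (verts (sub r 0))

module GreedyWalk {n : ℕ} where

  bestChild : Sub → VSet n → Fin 3
  bestChild S W = proj₁ (argmax (λ c → cntIn S W (child S c)))

  descend : Sub × VSet n → Sub × VSet n
  descend (S , W) = child S (bestChild S W) , restrict W (child S (bestChild S W))

  walk : Sub × VSet n → ℕ → Sub × VSet n
  walk x zero    = x
  walk x (suc i) = descend (walk x i)

  height-walk : ∀ x i → height (proj₁ (walk x i)) ≡ height (proj₁ x) ∸ i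
  height-walk x zero    = refl
  height-walk x (suc i) = begin
    height (proj₁ (walk x i)) ∸ 1 ≡⟨ cong (_∸ 1) (height-walk x i) ⟩
    height (proj₁ x) ∸ i ∸ 1      ≡⟨ ∸-+-assoc (height (proj₁ x)) i 1 ⟩
    height (proj₁ x) ∸ (i + 1)    ≡⟨ cong (height (proj₁ x) ∸_) (+-comm i 1) ⟩
    height (proj₁ x) ∸ suc i      ∎
    where open ≡-Reasoning

  descend-largest : ∀ S W → 0 < height S → LargestImm S W (proj₁ (descend (S , W)))
  descend-largest S W h>0 =
    (h>0 , bestChild S W , refl) ,
    λ { _ (_ , c , refl) → proj₂ (argmax (λ c' → cntIn S W (child S c'))) c }

  greedySeq : ∀ d V q → 1 ≤ q → q ≤ suc d → LargestSeq (tree d) V q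
  greedySeq d V q 1≤q q≤d+1 = record
    { Ts    = λ i → proj₁ (walk (tree d , V) i)
    ; Vs    = λ i → proj₂ (walk (tree d , V) i)
    ; pos   = 1≤q
    ; first = refl , refl
    ; step  = λ i i+1<q → descend-largest _ _ (not-leaf i (≤-trans i+1<q q≤d+1)) , refl
    }
    where
    not-leaf : ∀ i → suc i < suc d → 0 < height (proj₁ (walk (tree d , V) i))
    not-leaf i (s≤s i<d) rewrite height-walk (tree d , V) i = m<n⇒0<n∸m i<d

open GreedyWalk

-- The greedy walk, stopped just after its first loss of p occupied copies.
lemma4 : (p : ℕ) → 0 < p → (H : Graph) → (d : ℕ) → (V : VSet (Graph.n H))
       → p < ∣OC∣ (tree d) V
       → ∃[ q ] Σ (LargestSeq (tree d) V q) (Lacking p)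
lemma4 p p>0 H d V p<O₀ = stop-after (first-crossing Lost Lost? ¬lost-0 d lost-d)
  where
  O : ℕ → ℕ
  O i = ∣OC∣ (proj₁ (walk (tree d , V) i)) (proj₂ (walk (tree d , V) i))

  Lost : ℕ → Set
  Lost i = p + O i ≤ O 0

  Lost? : Decidable Lost
  Lost? i = p + O i ≤? O 0

  ¬lost-0 : ¬ Lost 0
  ¬lost-0 lost = n≮n 0 (<-≤-trans p>0 (+-cancelʳ-≤ (O 0) p 0 lost))

  O-d≤1 : O d ≤ 1
  O-d≤1 = ∣OC∣-leaf (proj₁ (walk (tree d , V) d)) (proj₂ (walk (tree d , V) d))
                    (trans (height-walk (tree d , V) d) (n∸n≡0 d))

  lost-d : Lost d
  lost-d = begin
    p + O d ≤⟨ +-monoʳ-≤ p O-d≤1 ⟩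
    p + 1   ≡⟨ +-comm p 1 ⟩
    suc p   ≤⟨ p<O₀ ⟩
    O 0     ∎
    where open ≤-Reasoning

  stop-after : ∃[ j ] (j < d × ¬ Lost j × Lost (suc j))
             → ∃[ q ] Σ (LargestSeq (tree d) V q) (Lacking p)
  stop-after (j , j<d , ¬lost-j , lost-j+1) =
    suc (suc j) , greedySeq d V (suc (suc j)) (s≤s z≤n) (s≤s j<d) ,
    s≤s (s≤s z≤n) , lost-j+1 , ≰⇒> ¬lost-j
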